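{- For every integer $n > 2$, the three integers $M_n - 4$, $M_n - 2$, $M_n$, where $M_n = 2^n - 1$, all belong to $\mathcal{D}$; that is, $(M_n-4, M_n-2, M_n)$ is a triplet of $\mathcal{D}$.
   Context: Let $\mathcal{D}$ (OEIS A036991) be the set of positive integers $m$ such that, in the binary expansion of $m$ written without leading zeros, every suffix contains at least as many digits $1$ as digits $0$. A triplet of $\mathcal{D}$ is a triple $(t-4, t-2, t)$ of integers all belonging to $\mathcal{D}$. $M_n = 2^n-1$ is the $n$-th Mersenne number. -}

module Defs where

open import Data.Nat using (ℕ; zero; suc; _+_; _∸_; _^_; _≤_; _<_)
open import Data.Nat.DivMod using (_/_; _%_; m/n<m)
open import Data.Nat.Induction using (<-rec)
open import Data.List using (List; []; _∷_; length; take)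
open import Data.Product using (_×_)

ones : List ℕ → ℕ
ones [] = 0
ones (0 ∷ ds) = ones ds
ones (suc _ ∷ ds) = suc (ones ds)

zeros : List ℕ → ℕ
zeros [] = 0
zeros (0 ∷ ds) = suc (zeros ds)
zeros (suc _ ∷ ds) = zeros ds

-- Binary expansion of m without leading zeros, least significant digit first.
-- bits 0 = [] ; bits m = (m % 2) ∷ bits (m / 2) for m > 0.
bits : ℕ → List ℕ
bits = <-rec (λ _ → List ℕ) step
  where
  step : (m : ℕ) → ({k : ℕ} → k < m → List ℕ) → List ℕ
  step zero    rec = []
  step (suc m) rec = (suc m % 2) ∷ rec {suc m / 2} (m/n<m (suc m) 2 (Data.Nat.s≤s (Data.Nat.s≤s Data.Nat.z≤n)))

-- The suffixes (of the usual MSB-first written expansion) of length k are exactly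
-- the first k digits of the LSB-first list.
-- 𝒟 (OEIS A036991): positive m such that every suffix of its binary expansion
-- has at least as many 1s as 0s.
InD : ℕ → Set
InD m = (0 < m) × ((k : ℕ) → k ≤ length (bits m) → zeros (take k (bits m)) ≤ ones (take k (bits m)))

M : ℕ → ℕ
M n = 2 ^ n ∸ 1

-- Triplet of 𝒟: (t-4, t-2, t) all in 𝒟 (t ≥ 4 ensures these are integers ≥ 0 read correctly).
Triplet : ℕ → Set
Triplet t = (4 ≤ t) × InD (t ∸ 4) × InD (t ∸ 2) × InD t

-- A positive m lies in 𝒟 exactly when its digit list bits m (least significant first) is balanced:
-- every prefix has at least as many 1s as 0s.  Balance survives prepending 1 or 10.  Writing
-- x = M (n − 3), the three numbers are M n = 8x + 7, M n − 2 = 8x + 5 and M n − 4 = 8x + 3, with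
-- expansions 111·bits x, 101·bits x and 11·bits(2x); the last is 11 when
-- x = 0 and 110·bits x otherwise.  Finally bits x is balanced, since M (k + 1) = 2 M k + 1 only
-- prepends a 1 to the expansion of M k.
module Submission where

open import Defs
open import Data.Nat using (ℕ; zero; suc; _+_; _*_; _∸_; _^_; _≤_; _<_; _<′_; <′-base; <′-step; z≤n; s≤s)
open import Data.Nat.Properties using (≤-refl; m≤n⇒m≤1+n; <⇒<′; m^n>0)
open import Data.Nat.DivMod using (_%_; _/_; m/n<m; [m+kn]%n≡m%n; m*n%n≡0; m*n/n≡m; +-distrib-/)
open import Data.Nat.Induction using (<′-wellFounded; <′-wellFounded′)
open import Data.Nat.Tactic.RingSolver using (solve-∀)
open import Data.List using (List; []; _∷_; take)
open import Data.Product using (_,_)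
open import Relation.Binary.PropositionalEquality using (_≡_; refl; sym; trans; cong; cong₂; subst; module ≡-Reasoning)
open import Function using (_∘_)

Balanced : List ℕ → Set
Balanced ds = ∀ k → zeros (take k ds) ≤ ones (take k ds)

balanced-[] : Balanced []
balanced-[] zero    = z≤n
balanced-[] (suc k) = z≤n

balanced-1∷ : ∀ {ds} → Balanced ds → Balanced (1 ∷ ds)
balanced-1∷ b zero    = z≤n
balanced-1∷ b (suc k) = m≤n⇒m≤1+n (b k)

balanced-10∷ : ∀ {ds} → Balanced ds → Balanced (1 ∷ 0 ∷ ds)
balanced-10∷ b zero          = z≤n
balanced-10∷ b (suc zero)    = z≤n
balanced-10∷ b (suc (suc k)) = s≤s (b k)

InD-if-balanced : ∀ {m} → 0 < m → Balanced (bits m) → InD m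
InD-if-balanced 0<m b = 0<m , λ k _ → b k

-- bits (suc m) only unfolds once the accessibility proof passed to the recursive call is
-- recognised as the canonical one for suc m / 2.
<′-wellFounded′-canonical : ∀ n y (y<′n : y <′ n) → <′-wellFounded′ n y<′n ≡ <′-wellFounded y
<′-wellFounded′-canonical (suc n) .n <′-base         = refl
<′-wellFounded′-canonical (suc n) y  (<′-step y<′n) = <′-wellFounded′-canonical n y y<′n

bits-suc : ∀ m → bits (suc m) ≡ suc m % 2 ∷ bits (suc m / 2)
bits-suc m rewrite <′-wellFounded′-canonical (suc m) (suc m / 2)
                     (<⇒<′ (m/n<m (suc m) 2 (s≤s (s≤s z≤n)))) = refl

bits-1+2* : ∀ x → bits (1 + x * 2) ≡ 1 ∷ bits x
bits-1+2* x = trans (bits-suc (x * 2)) (cong₂ _∷_ ([m+kn]%n≡m%n 1 x 2) (cong bits half))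
  where
  half : (1 + x * 2) / 2 ≡ x
  half = trans (+-distrib-/ 1 (x * 2) (subst (λ r → 1 + r < 2) (sym (m*n%n≡0 x 2)) ≤-refl))
               (m*n/n≡m x 2)

bits-suc*2 : ∀ y → bits (suc y * 2) ≡ 0 ∷ bits (suc y)
bits-suc*2 y = trans (bits-suc (suc (y * 2)))
                     (cong₂ _∷_ (m*n%n≡0 (suc y) 2) (cong bits (m*n/n≡m (suc y) 2)))

balanced-bits-1+2* : ∀ x → Balanced (bits x) → Balanced (bits (1 + x * 2))
balanced-bits-1+2* x b = subst Balanced (sym (bits-1+2* x)) (balanced-1∷ b)

-- For x = 0 the expansion of 4x + 1 is just 1, otherwise it is 1 0 followed by that of x.
balanced-bits-1+4* : ∀ x → Balanced (bits x) → Balanced (bits (1 + x * 2 * 2))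
balanced-bits-1+4* zero    b = balanced-bits-1+2* 0 b
balanced-bits-1+4* (suc y) b =
  subst Balanced (sym (trans (bits-1+2* (suc y * 2)) (cong (1 ∷_) (bits-suc*2 y)))) (balanced-10∷ b)

M-suc : ∀ n → M (suc n) ≡ 1 + M n * 2
M-suc n = double-pred (2 ^ n) (m^n>0 2 n)
  where
  double-pred : ∀ p → 0 < p → 2 * p ∸ 1 ≡ 1 + (p ∸ 1) * 2
  double-pred (suc q) _ = cong (_∸ 1) (expand q)
    where
    expand : ∀ q → 2 * suc q ≡ 2 + q * 2
    expand = solve-∀

balanced-bits-M : ∀ n → Balanced (bits (M n))
balanced-bits-M zero    = balanced-[]
balanced-bits-M (suc n) =
  subst (Balanced ∘ bits) (sym (M-suc n)) (balanced-bits-1+2* (M n) (balanced-bits-M n))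

-- With t = 8x + 7 in this nested form, t ∸ 2 and t ∸ 4 reduce to 1 + (1 + 2x)·4 and 1 + (1 + 4x)·2.
triplet-8*+7 : ∀ x → Balanced (bits x) → Triplet (1 + (1 + (1 + x * 2) * 2) * 2)
triplet-8*+7 x b =
    s≤s (s≤s (s≤s (s≤s z≤n)))
  , InD-if-balanced (s≤s z≤n) (balanced-bits-1+2* (1 + x * 2 * 2) (balanced-bits-1+4* x b))
  , InD-if-balanced (s≤s z≤n) (balanced-bits-1+4* (1 + x * 2) (balanced-bits-1+2* x b))
  , InD-if-balanced (s≤s z≤n)
      (balanced-bits-1+2* (1 + (1 + x * 2) * 2) (balanced-bits-1+2* (1 + x * 2) (balanced-bits-1+2* x b)))

proposition3 : (n : ℕ) → 2 < n → Triplet (M n)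
proposition3 (suc (suc (suc k))) (s≤s (s≤s (s≤s z≤n))) =
  subst Triplet (sym M-3+k) (triplet-8*+7 (M k) (balanced-bits-M k))
  where
  open ≡-Reasoning
  M-3+k : M (3 + k) ≡ 1 + (1 + (1 + M k * 2) * 2) * 2
  M-3+k = begin
    M (3 + k)                             ≡⟨ M-suc (2 + k) ⟩
    1 + M (2 + k) * 2                     ≡⟨ cong (λ t → 1 + t * 2) (M-suc (1 + k)) ⟩
    1 + (1 + M (1 + k) * 2) * 2           ≡⟨ cong (λ t → 1 + (1 + t * 2) * 2) (M-suc k) ⟩
    1 + (1 + (1 + M k * 2) * 2) * 2       ∎
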